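{- Let $\bm\lambda=(R_1,\dots,R_n)$ be a horizontal-strip with $R_1\nleftrightarrow R_2$. Let $\bm\mu=(S_1,\dots,S_n)$ be a horizontal-strip with an isomorphism $\varphi:\Pi(\bm\lambda)\to\Pi(\bm\mu)$, and let $i=\varphi_1$, $j=\varphi_2$. If $l(R_2)>l(R_1)$, assume also that $l(S_j)>l(S_i)$. Then $l(S_j)-l(S_i)\ge l(R_2)-l(R_1)$, with equality only if $i<j$.
   Context: A row is $R=a/b=\{(1,j):b+1\le j\le a\}$ ($a\ge b\ge0$ integers); $l(R)=b$, $|R|$ its number of cells, $R^+=(a+1)/(b+1)$. For rows $R,R'$: $M(R,R')=|R\cap R'|$ if $l(R)\le l(R')$, else $|R\cap R'^+|$. Rows commute, $R\leftrightarrow R'$, if $M(R,R')=M(R',R)$, else $R\nleftrightarrow R'$. A horizontal-strip is a sequence of rows $(R_1,\dots,R_n)$; $M_{i,j}=M(R_{\min(i,j)},R_{\max(i,j)})$ for $i\neq j$. An isomorphism $\varphi:\Pi(\bm\lambda)\to\Pi(\bm\mu)$ is a permutation of $\{1,\dots,n\}$ with $|R_t|=|S_{\varphi_t}|$ for all $t$ and $M_{s,t}(\bm\lambda)=M_{\varphi_s,\varphi_t}(\bm\mu)$ for all $s\ne t$. -}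

module Defs where

open import Data.Nat using (ℕ; suc; _≤_; _⊓_; _⊔_; _∸_)
open import Data.Fin using (Fin; _<_)
open import Data.Fin.Permutation using (Permutation′; _⟨$⟩ʳ_)
open import Relation.Binary.PropositionalEquality using (_≡_)
open import Relation.Nullary using (¬_)
open import Data.Product using (_×_)

-- A row a/b = {(1,j) : b+1 ≤ j ≤ a}, with a ≥ b ≥ 0.
record Row : Set where
  constructor _/_∶_
  field
    top : ℕ
    len : ℕ
    len≤top : len ≤ top
open Row public

l : Row → ℕ
l R = len R

size : Row → ℕ
size R = top R ∸ len R

-- |a/b ∩ a'/b'| = min(a,a') ∸ max(b,b')   (cells j with max(b,b') < j ≤ min(a,a'))
∣_∩_∣ : Row → Row → ℕ
∣ R ∩ R' ∣ = (top R ⊓ top R') ∸ (len R ⊔ len R')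

_⁺ : Row → Row
(a / b ∶ p) ⁺ = suc a / suc b ∶ Data.Nat.s≤s p

M : Row → Row → ℕ
M R R' with Data.Nat._≤?_ (l R) (l R')
... | Relation.Nullary.yes _ = ∣ R ∩ R' ∣
... | Relation.Nullary.no  _ = ∣ R ∩ (R' ⁺) ∣

_↔R_ : Row → Row → Set
R ↔R R' = M R R' ≡ M R' R

-- A horizontal-strip of n rows (R_1,…,R_n), indexed by Fin n (index 0 = R_1).
Strip : ℕ → Set
Strip n = Fin n → Row

Mᵢⱼ : ∀ {n} → Strip n → Fin n → Fin n → ℕ
Mᵢⱼ λs s t with Data.Fin._≤?_ s t
... | Relation.Nullary.yes _ = M (λs s) (λs t)
... | Relation.Nullary.no  _ = M (λs t) (λs s)

IsIso : ∀ {n} → Strip n → Strip n → Permutation′ n → Set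
IsIso λs μs φ =
  (∀ t → size (λs t) ≡ size (μs (φ ⟨$⟩ʳ t))) ×
  (∀ s t → ¬ s ≡ t → Mᵢⱼ λs s t ≡ Mᵢⱼ μs (φ ⟨$⟩ʳ s) (φ ⟨$⟩ʳ t))

-- For rows R, R′ of sizes p, q whose lengths differ by d = l R′ − l R, the number M(R, R′) depends
-- only on p, q and d, and M(R′, R) is the same function evaluated at d − 1.  As a function of d it
-- is nondecreasing for d < 0, nonincreasing for d ≥ 0, and takes equal values at −1 and 0.  So
-- R₁ ↮ R₂ says that it jumps between d − 1 and d, which makes d the leftmost point (among those
-- of the sign allowed by the hypothesis) where it takes the value M(R₁, R₂).  The isomorphism says
-- that the same function, for the offset d′ = l S_j − l S_i, takes this value at d′ if i < j and
-- at d′ − 1 if j < i; hence d ≤ d′, and d < d′ when j < i.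
module Submission where

open import Defs
open import Data.Nat as ℕ using (ℕ; suc; _>_; _∸_; _⊓_; _⊔_; z≤n; s≤s)
open import Data.Nat.Properties as ℕP using ()
open import Data.Fin using (zero; suc; _<_)
open import Data.Fin.Properties as FinP using ()
open import Data.Fin.Permutation using (Permutation′; _⟨$⟩ʳ_)
open import Data.Integer as ℤ
  using (ℤ; +_; -[1+_]; +0; +[1+_]; _-_; _≥_; -_; pred; _⊖_; -≤+; -≤-; +≤+; +<+)
open import Data.Integer.Properties as ℤP using ()
open import Data.Product using (_×_; _,_)
open import Function.Base using (_∘_)
open import Function.Bundles using (Injection)
open import Function.Properties.Inverse using (↔⇒↣)
open import Relation.Binary.Core using (_Preserves_⟶_)
open import Relation.Binary.Definitions using (tri<; tri≈; tri>)
open import Relation.Binary.PropositionalEquality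
open import Relation.Nullary using (¬_; yes; no; contradiction)

antitone-jump-right : ∀ {f : ℕ → ℕ} → f Preserves ℕ._≤_ ⟶ ℕ._≥_ → ∀ {e x} →
  f (suc e) ≢ f e → f x ≡ f (suc e) → e ℕ.< x
antitone-jump-right {f} antitone {e} {x} jump fx≡ with e ℕ.<? x
... | yes e<x = e<x
... | no e≮x = contradiction
  (ℕP.≤-antisym (antitone (ℕP.n≤1+n e))
                (ℕP.≤-trans (antitone (ℕP.≮⇒≥ e≮x)) (ℕP.≤-reflexive fx≡)))
  jump

antitone-jump-left : ∀ {f : ℕ → ℕ} → f Preserves ℕ._≤_ ⟶ ℕ._≥_ → ∀ {e x} →
  f (suc e) ≢ f e → f x ≡ f e → x ℕ.≤ e
antitone-jump-left {f} antitone {e} {x} jump fx≡ with x ℕ.≤? e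
... | yes x≤e = x≤e
... | no x≰e = contradiction
  (ℕP.≤-antisym (antitone (ℕP.n≤1+n e))
                (ℕP.≤-trans (ℕP.≤-reflexive (sym fx≡)) (antitone (ℕP.≰⇒> x≰e))))
  jump

overlapℕ : ℕ → ℕ → ℕ → ℕ
overlapℕ p q δ = (p ∸ δ) ⊓ q

overlapℕ-antitone : ∀ p q → overlapℕ p q Preserves ℕ._≤_ ⟶ ℕ._≥_
overlapℕ-antitone p q δ≤δ′ = ℕP.⊓-monoˡ-≤ q (ℕP.∸-monoʳ-≤ p δ≤δ′)

overlapℤ : ℕ → ℕ → ℤ → ℕ
overlapℤ p q (+ δ)     = overlapℕ p q δ
overlapℤ p q -[1+ δ ] = overlapℕ q p δ

overlapℤ-neg : ∀ p q d → overlapℤ q p (- d) ≡ overlapℤ p q (pred d)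
overlapℤ-neg p q +0        = refl
overlapℤ-neg p q +[1+ δ ] = refl
overlapℤ-neg p q -[1+ δ ] = refl

overlapℤ-jump⇒≤ : ∀ p q {d x} → overlapℤ p q d ≢ overlapℤ p q (pred d) →
  overlapℤ p q x ≡ overlapℤ p q d → (+0 ℤ.< d → +0 ℤ.≤ x) → d ℤ.≤ x
overlapℤ-jump⇒≤ p q {+0}       jump _ _ = contradiction (ℕP.⊓-comm p q) jump
overlapℤ-jump⇒≤ p q {+[1+ e ]} {+ x} jump level _ =
  +≤+ (antitone-jump-right (overlapℕ-antitone p q) jump level)
overlapℤ-jump⇒≤ p q {+[1+ e ]} { -[1+ x ]} _ _ nonneg with nonneg (+<+ (s≤s z≤n))
... | ()
overlapℤ-jump⇒≤ p q { -[1+ e ]} {+ x} _ _ _ = -≤+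
overlapℤ-jump⇒≤ p q { -[1+ e ]} { -[1+ x ]} jump level _ =
  -≤- (antitone-jump-left (overlapℕ-antitone q p) (jump ∘ sym) level)

top≡l+size : (R : Row) → top R ≡ l R ℕ.+ size R
top≡l+size R = sym (ℕP.m+[n∸m]≡n (len≤top R))

∣∩∣-comm : (R R′ : Row) → ∣ R ∩ R′ ∣ ≡ ∣ R′ ∩ R ∣
∣∩∣-comm R R′ = cong₂ _∸_ (ℕP.⊓-comm (top R) (top R′)) (ℕP.⊔-comm (len R) (len R′))

∣∩∣≡overlapℕ : (R R′ : Row) (δ : ℕ) → l R′ ≡ l R ℕ.+ δ →
  ∣ R ∩ R′ ∣ ≡ overlapℕ (size R) (size R′) δ
∣∩∣≡overlapℕ R R′ δ l′≡l+δ = begin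
  (top R ⊓ top R′) ∸ (b ⊔ b′)
    ≡⟨ cong₂ (λ a a′ → (a ⊓ a′) ∸ (b ⊔ b′)) (top≡l+size R) (top≡l+size R′) ⟩
  ((b ℕ.+ p) ⊓ (b′ ℕ.+ q)) ∸ (b ⊔ b′)
    ≡⟨ cong (((b ℕ.+ p) ⊓ (b′ ℕ.+ q)) ∸_) (ℕP.m≤n⇒m⊔n≡n b≤b′) ⟩
  ((b ℕ.+ p) ⊓ (b′ ℕ.+ q)) ∸ b′
    ≡⟨ ℕP.∸-distribʳ-⊓ b′ (b ℕ.+ p) (b′ ℕ.+ q) ⟩
  ((b ℕ.+ p) ∸ b′) ⊓ ((b′ ℕ.+ q) ∸ b′)
    ≡⟨ cong₂ _⊓_ (trans (cong ((b ℕ.+ p) ∸_) l′≡l+δ) (ℕP.[m+n]∸[m+o]≡n∸o b p δ))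
                 (ℕP.m+n∸m≡n b′ q) ⟩
  (p ∸ δ) ⊓ q ∎
  where
  open ≡-Reasoning
  b b′ p q : ℕ
  b = l R
  b′ = l R′
  p = size R
  q = size R′
  b≤b′ : b ℕ.≤ b′
  b≤b′ = subst (b ℕ.≤_) (sym l′≡l+δ) (ℕP.m≤m+n b δ)

offset : Row → Row → ℤ
offset R R′ = + l R′ - + l R

[+m+n]-[+m]≡+n : ∀ m n → + (m ℕ.+ n) - + m ≡ + n
[+m+n]-[+m]≡+n m n = begin
  + (m ℕ.+ n) - + m      ≡⟨ ℤP.[+m]-[+n]≡m⊖n (m ℕ.+ n) m ⟩
  (m ℕ.+ n) ⊖ m          ≡⟨ cong ((m ℕ.+ n) ⊖_) (sym (ℕP.+-identityʳ m)) ⟩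
  (m ℕ.+ n) ⊖ (m ℕ.+ 0)  ≡⟨ ℤP.+-cancelˡ-⊖ m n 0 ⟩
  n ⊖ 0                  ≡⟨ ℤP.⊖-≥ z≤n ⟩
  + n                    ∎
  where open ≡-Reasoning

[+m]-[+1+m+n]≡-[1+n] : ∀ m n → + m - + (suc m ℕ.+ n) ≡ -[1+ n ]
[+m]-[+1+m+n]≡-[1+n] m n = begin
  + m - + (suc m ℕ.+ n)      ≡⟨ ℤP.[+m]-[+n]≡m⊖n m (suc m ℕ.+ n) ⟩
  m ⊖ (suc m ℕ.+ n)          ≡⟨ cong₂ _⊖_ (sym (ℕP.+-identityʳ m)) (sym (ℕP.+-suc m n)) ⟩
  (m ℕ.+ 0) ⊖ (m ℕ.+ suc n)  ≡⟨ ℤP.+-cancelˡ-⊖ m 0 (suc n) ⟩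
  -[1+ n ]                   ∎
  where open ≡-Reasoning

offset-swap : (R R′ : Row) → offset R′ R ≡ - offset R R′
offset-swap R R′ = begin
  + l R - + l R′  ≡⟨ ℤP.[+m]-[+n]≡m⊖n (l R) (l R′) ⟩
  l R ⊖ l R′      ≡⟨ ℤP.⊖-swap (l R) (l R′) ⟩
  - (l R′ ⊖ l R)  ≡⟨ cong -_ (ℤP.[+m]-[+n]≡m⊖n (l R′) (l R)) ⟨
  - offset R R′   ∎
  where open ≡-Reasoning

0<offset⇒shorter : ∀ R R′ → +0 ℤ.< offset R R′ → l R ℕ.< l R′
0<offset⇒shorter R R′ 0<d = ℕP.≰⇒> λ l′≤l →
  ℤP.<⇒≱ 0<d (begin
    offset R R′   ≡⟨ ℤP.[+m]-[+n]≡m⊖n (l R′) (l R) ⟩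
    l R′ ⊖ l R    ≤⟨ ℤP.⊖-monoˡ-≤ (l R) l′≤l ⟩
    l R ⊖ l R     ≡⟨ ℤP.n⊖n≡0 (l R) ⟩
    +0            ∎)
  where open ℤP.≤-Reasoning

shorter⇒0<offset : ∀ R R′ → l R ℕ.< l R′ → +0 ℤ.< offset R R′
shorter⇒0<offset R R′ l<l′ = begin-strict
  +0            ≡⟨ ℤP.n⊖n≡0 (l R) ⟨
  l R ⊖ l R     <⟨ ℤP.⊖-monoˡ-< (l R) l<l′ ⟩
  l R′ ⊖ l R    ≡⟨ ℤP.[+m]-[+n]≡m⊖n (l R′) (l R) ⟨
  offset R R′   ∎
  where open ℤP.≤-Reasoning

M≡overlapℤ : (R R′ : Row) → M R R′ ≡ overlapℤ (size R) (size R′) (offset R R′)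
M≡overlapℤ R@(_ / b ∶ _) R′@(_ / b′ ∶ _) with b ℕ.≤? b′
... | yes b≤b′ with ℕP.m≤n⇒∃[o]m+o≡n b≤b′
...   | δ , refl = begin
  ∣ R ∩ R′ ∣                                ≡⟨ ∣∩∣≡overlapℕ R R′ δ refl ⟩
  overlapℤ (size R) (size R′) (+ δ)          ≡⟨ cong (overlapℤ (size R) (size R′)) ([+m+n]-[+m]≡+n b δ) ⟨
  overlapℤ (size R) (size R′) (offset R R′) ∎
  where open ≡-Reasoning
M≡overlapℤ R@(_ / b ∶ _) R′@(_ / b′ ∶ _) | no b≰b′ with ℕP.m≤n⇒∃[o]m+o≡n (ℕP.≰⇒> b≰b′)
...   | δ , refl = begin
  ∣ R ∩ R′ ⁺ ∣                              ≡⟨ ∣∩∣-comm R (R′ ⁺) ⟩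
  ∣ R′ ⁺ ∩ R ∣                              ≡⟨ ∣∩∣≡overlapℕ (R′ ⁺) R δ refl ⟩
  overlapℤ (size R) (size R′) -[1+ δ ]      ≡⟨ cong (overlapℤ (size R) (size R′)) ([+m]-[+1+m+n]≡-[1+n] b′ δ) ⟨
  overlapℤ (size R) (size R′) (offset R R′) ∎
  where open ≡-Reasoning

M-swap≡overlapℤ : (R R′ : Row) → M R′ R ≡ overlapℤ (size R) (size R′) (pred (offset R R′))
M-swap≡overlapℤ R R′ = begin
  M R′ R                                           ≡⟨ M≡overlapℤ R′ R ⟩
  overlapℤ (size R′) (size R) (offset R′ R)        ≡⟨ cong (overlapℤ (size R′) (size R)) (offset-swap R R′) ⟩
  overlapℤ (size R′) (size R) (- offset R R′)      ≡⟨ overlapℤ-neg (size R) (size R′) (offset R R′) ⟩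
  overlapℤ (size R) (size R′) (pred (offset R R′)) ∎
  where open ≡-Reasoning

module _ {R₁ R₂ S₁ S₂ : Row} (R₁↮R₂ : ¬ R₁ ↔R R₂)
         (size₁ : size S₁ ≡ size R₁) (size₂ : size S₂ ≡ size R₂)
         (longer⇒longer : l R₂ > l R₁ → l S₂ > l S₁) where

  private
    p q : ℕ
    p = size R₁
    q = size R₂
    d d′ : ℤ
    d = offset R₁ R₂
    d′ = offset S₁ S₂

    jump : overlapℤ p q d ≢ overlapℤ p q (pred d)
    jump eq = R₁↮R₂ (trans (M≡overlapℤ R₁ R₂) (trans eq (sym (M-swap≡overlapℤ R₁ R₂))))

    resize : ∀ e → overlapℤ (size S₁) (size S₂) e ≡ overlapℤ p q e
    resize e = cong₂ (λ p q → overlapℤ p q e) size₁ size₂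

    positive⇒positive : +0 ℤ.< d → +0 ℤ.< d′
    positive⇒positive = shorter⇒0<offset S₁ S₂ ∘ longer⇒longer ∘ 0<offset⇒shorter R₁ R₂

  offset-≤-of-M≡ : M R₁ R₂ ≡ M S₁ S₂ → d ℤ.≤ d′
  offset-≤-of-M≡ M≡ = overlapℤ-jump⇒≤ p q jump level (ℤP.<⇒≤ ∘ positive⇒positive)
    where
    level : overlapℤ p q d′ ≡ overlapℤ p q d
    level = begin
      overlapℤ p q d′                     ≡⟨ resize d′ ⟨
      overlapℤ (size S₁) (size S₂) d′     ≡⟨ M≡overlapℤ S₁ S₂ ⟨
      M S₁ S₂                             ≡⟨ M≡ ⟨
      M R₁ R₂                             ≡⟨ M≡overlapℤ R₁ R₂ ⟩
      overlapℤ p q d                      ∎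
      where open ≡-Reasoning

  offset-<-of-M≡-swapped : M R₁ R₂ ≡ M S₂ S₁ → d ℤ.< d′
  offset-<-of-M≡-swapped M≡ =
    ℤP.i≤pred[j]⇒i<j (overlapℤ-jump⇒≤ p q jump level (ℤP.i<j⇒i≤pred[j] ∘ positive⇒positive))
    where
    level : overlapℤ p q (pred d′) ≡ overlapℤ p q d
    level = begin
      overlapℤ p q (pred d′)                  ≡⟨ resize (pred d′) ⟨
      overlapℤ (size S₁) (size S₂) (pred d′)  ≡⟨ M-swap≡overlapℤ S₁ S₂ ⟨
      M S₂ S₁                                 ≡⟨ M≡ ⟨
      M R₁ R₂                                 ≡⟨ M≡overlapℤ R₁ R₂ ⟩
      overlapℤ p q d                          ∎
      where open ≡-Reasoning

Mᵢⱼ-< : ∀ {n} (λs : Strip n) {s t} → s < t → Mᵢⱼ λs s t ≡ M (λs s) (λs t)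
Mᵢⱼ-< λs {s} {t} s<t with s FinP.≤? t
... | yes _    = refl
... | no s≰t = contradiction (ℕP.<⇒≤ s<t) s≰t

Mᵢⱼ-> : ∀ {n} (λs : Strip n) {s t} → t < s → Mᵢⱼ λs s t ≡ M (λs t) (λs s)
Mᵢⱼ-> λs {s} {t} t<s with s FinP.≤? t
... | yes s≤t = contradiction s≤t (ℕP.<⇒≱ t<s)
... | no _     = refl

proposition5p9 : (m : ℕ) (λs μs : Strip (suc (suc m))) (φ : Permutation′ (suc (suc m))) →
    ¬ (λs zero ↔R λs (suc zero)) →
    IsIso λs μs φ →
    (l (λs (suc zero)) > l (λs zero) →
      l (μs (φ ⟨$⟩ʳ suc zero)) > l (μs (φ ⟨$⟩ʳ zero))) →
    ((+ l (μs (φ ⟨$⟩ʳ suc zero)) - + l (μs (φ ⟨$⟩ʳ zero)))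
        ≥ (+ l (λs (suc zero)) - + l (λs zero)))
    × ((+ l (μs (φ ⟨$⟩ʳ suc zero)) - + l (μs (φ ⟨$⟩ʳ zero)))
        ≡ (+ l (λs (suc zero)) - + l (λs zero)) →
       (φ ⟨$⟩ʳ zero) < (φ ⟨$⟩ʳ suc zero))
proposition5p9 _ λs μs φ R₁↮R₂ (size≡ , M≡) longer⇒longer
  with FinP.<-cmp (φ ⟨$⟩ʳ zero) (φ ⟨$⟩ʳ suc zero)
... | tri< i<j _ _ = offset-≤-of-M≡ R₁↮R₂ (sym (size≡ zero)) (sym (size≡ (suc zero))) longer⇒longer
                       (trans (M≡ zero (suc zero) λ ()) (Mᵢⱼ-< μs i<j))
                   , λ _ → i<j
... | tri≈ _ i≡j _ = contradiction (Injection.injective (↔⇒↣ φ) i≡j) λ ()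
... | tri> _ _ j<i = ℤP.<⇒≤ d<d′ , λ d′≡d → contradiction (sym d′≡d) (ℤP.<⇒≢ d<d′)
  where
  d<d′ : offset (λs zero) (λs (suc zero)) ℤ.< offset (μs (φ ⟨$⟩ʳ zero)) (μs (φ ⟨$⟩ʳ suc zero))
  d<d′ = offset-<-of-M≡-swapped R₁↮R₂ (sym (size≡ zero)) (sym (size≡ (suc zero))) longer⇒longer
           (trans (M≡ zero (suc zero) λ ()) (Mᵢⱼ-> μs j<i))
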